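{- Let $\mathfrak D$ be a unique factorization domain of characteristic zero satisfying $\mathfrak D\cap\mathbb Q=\mathbb Z$ inside the field of fractions $Q(\mathfrak D)$. Let $b,e\in\mathbb N$ be such that $b$ (that is, $b\cdot 1_{\mathfrak D}$) is a prime element of $\mathfrak D$, and let $d=b^e$. Let $p\in\mathfrak D[x]$ be a nice polynomial of degree $d$ having $0$ as a root. Then: (a) all of the roots of $p$ are multiples of $b$ in $\mathfrak D$; (b) at most $e$ of the $d-1$ critical points of $p$ (counted with multiplicity) are not multiples of $b$ in $\mathfrak D$; (c) if moreover $0$ is a root of $p$ of multiplicity one and $b$ divides $e$ in $\mathfrak D$, then additionally: (c1) at least one nonzero root of $p$ is a multiple of $b^2$ in $\mathfrak D$; (c2) at most $e-1$ of the critical points of $p$ (counted with multiplicity) are not multiples of $b$ in $\mathfrak D$.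
   Context: For an integral domain $\mathfrak D$ of characteristic zero, $\mathbb Z$ is identified with the subring $\mathbb Z\cdot 1_{\mathfrak D}$ and $\mathbb Q$ with the subfield $\mathbb Q\cdot 1_{\mathfrak D}$ of $Q(\mathfrak D)$. The derivative $p'$ is the formal derivative. A polynomial of positive degree $n$ splits over $\mathfrak D$ if it equals $c\prod_{i=1}^n(x-x_i)$ with $c,x_1,\dots,x_n\in\mathfrak D$, $c\neq0$. A polynomial $p\in\mathfrak D[x]$ of degree $d\ge2$ is called nice if both $p$ and $p'$ split over $\mathfrak D$; its roots are the $d$ roots of $p$ and its critical points are the $d-1$ roots of $p'$, each repeated according to multiplicity. $\mathbb N$ denotes the positive integers. -}

module Defs where

open import Level using (Level; _⊔_)
open import Algebra.Bundles using (CommutativeRing)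
open import Data.Nat as ℕ using (ℕ; zero; suc; _≤_; _∸_; _^_)
open import Data.Integer as ℤ using (ℤ; +_; -[1+_])
open import Data.List using (List; []; _∷_; length; map; lookup)
open import Data.List.Relation.Unary.All using (All)
open import Data.Fin using (Fin) renaming (zero to fzero; suc to fsuc)
open import Data.Product using (Σ; ∃; _×_; _,_)
open import Data.Sum using (_⊎_)
open import Relation.Nullary using (¬_)
open import Relation.Binary.PropositionalEquality using (_≡_; _≢_)
open import Function.Bundles using (_↔_; Inverse)
open import Function.Definitions using (Injective)

-- Counting with multiplicity: "at most k of the indices j : Fin m satisfy P".
-- There is an injective listing of length k' ≤ k covering every j with P j.
AtMost : ∀ {a} {m : ℕ} → ℕ → (Fin m → Set a) → Set a
AtMost {m = m} k P =
  Σ ℕ λ k' → k' ≤ k × Σ (Fin k' → Fin m) λ f →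
    Injective _≡_ _≡_ f × (∀ j → P j → ∃ λ i → f i ≡ j)

module _ {c ℓ : Level} (R : CommutativeRing c ℓ) where
  open CommutativeRing R

  fromℕ : ℕ → Carrier
  fromℕ zero    = 0#
  fromℕ (suc n) = 1# + fromℕ n

  fromℤ : ℤ → Carrier
  fromℤ (+ n)      = fromℕ n
  fromℤ -[1+ n ]   = - fromℕ (suc n)

  _∣_ : Carrier → Carrier → Set (c ⊔ ℓ)
  a ∣ x = ∃ λ y → x ≈ a * y

  IsUnit : Carrier → Set (c ⊔ ℓ)
  IsUnit u = ∃ λ v → u * v ≈ 1#

  Associated : Carrier → Carrier → Set (c ⊔ ℓ)
  Associated a b = ∃ λ u → IsUnit u × a ≈ u * b

  IsIntegralDomain : Set (c ⊔ ℓ)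
  IsIntegralDomain = ¬ (1# ≈ 0#) × (∀ x y → x * y ≈ 0# → x ≈ 0# ⊎ y ≈ 0#)

  IsPrimeElem : Carrier → Set (c ⊔ ℓ)
  IsPrimeElem p = ¬ (p ≈ 0#) × ¬ IsUnit p × (∀ x y → p ∣ (x * y) → p ∣ x ⊎ p ∣ y)

  IsIrreducible : Carrier → Set (c ⊔ ℓ)
  IsIrreducible p = ¬ (p ≈ 0#) × ¬ IsUnit p × (∀ x y → p ≈ x * y → IsUnit x ⊎ IsUnit y)

  prodL : List Carrier → Carrier
  prodL []       = 1#
  prodL (x ∷ xs) = x * prodL xs

  IsUFD : Set (c ⊔ ℓ)
  IsUFD = IsIntegralDomain
        × (∀ x → ¬ (x ≈ 0#) → ¬ IsUnit x →
             ∃ λ (fs : List Carrier) → All IsIrreducible fs × x ≈ prodL fs)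
        × (∀ (fs gs : List Carrier) → All IsIrreducible fs → All IsIrreducible gs →
             prodL fs ≈ prodL gs →
             Σ (Fin (length fs) ↔ Fin (length gs)) λ π →
               ∀ i → Associated (lookup fs i) (lookup gs (Inverse.to π i)))

  CharZero : Set ℓ
  CharZero = ∀ n → n ≢ 0 → ¬ (fromℕ n ≈ 0#)

  -- D ∩ ℚ = ℤ inside Q(D): an element x of D equal to m/n (n ≠ 0) in Q(D),
  -- i.e. with n·x = m, is an integer k·1.
  IntersectQIsZ : Set (c ⊔ ℓ)
  IntersectQIsZ = ∀ (x : Carrier) (m : ℤ) (n : ℕ) → n ≢ 0 →
                  fromℕ n * x ≈ fromℤ m → ∃ λ (k : ℤ) → x ≈ fromℤ k

  -- Polynomials over R as coefficient lists (constant term first).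
  Poly : Set c
  Poly = List Carrier

  _+ₚ_ : Poly → Poly → Poly
  []       +ₚ q        = q
  (a ∷ p)  +ₚ []       = a ∷ p
  (a ∷ p)  +ₚ (b ∷ q)  = (a + b) ∷ (p +ₚ q)

  scaleₚ : Carrier → Poly → Poly
  scaleₚ a p = map (a *_) p

  _*ₚ_ : Poly → Poly → Poly
  []      *ₚ q = []
  (a ∷ p) *ₚ q = scaleₚ a q +ₚ (0# ∷ (p *ₚ q))

  linear : Carrier → Poly
  linear a = (- a) ∷ 1# ∷ []

  prodLinear : ∀ {n} → (Fin n → Carrier) → Poly
  prodLinear {zero}  xs = 1# ∷ []
  prodLinear {suc n} xs = linear (xs fzero) *ₚ prodLinear (λ i → xs (fsuc i))

  derivAux : ℕ → Poly → Poly
  derivAux k []      = []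
  derivAux k (a ∷ p) = (fromℕ k * a) ∷ derivAux (suc k) p

  deriv : Poly → Poly
  deriv []      = []
  deriv (a ∷ p) = derivAux 1 p

  -- equality of polynomials (coefficientwise, up to trailing zeros)
  data _≈ₚ_ : Poly → Poly → Set (c ⊔ ℓ) where
    []≈[] : [] ≈ₚ []
    []≈∷  : ∀ {b q} → b ≈ 0# → [] ≈ₚ q → [] ≈ₚ (b ∷ q)
    ∷≈[]  : ∀ {a p} → a ≈ 0# → p ≈ₚ [] → (a ∷ p) ≈ₚ []
    ∷≈∷   : ∀ {a b p q} → a ≈ b → p ≈ₚ q → (a ∷ p) ≈ₚ (b ∷ q)

  -- p is a nice polynomial of degree d: d ≥ 2, p = c ∏_{i<d} (x - roots i) with c ≠ 0
  -- (hence deg p = d), and p' = c' ∏_{j<d-1} (x - crit j) with c' ≠ 0.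
  record Nice (p : Poly) (d : ℕ) : Set (c ⊔ ℓ) where
    field
      two≤d     : 2 ≤ d
      lead      : Carrier
      lead≉0    : ¬ (lead ≈ 0#)
      roots     : Fin d → Carrier
      p-splits  : p ≈ₚ scaleₚ lead (prodLinear roots)
      lead'     : Carrier
      lead'≉0   : ¬ (lead' ≈ 0#)
      crit      : Fin (d ∸ 1) → Carrier
      p'-splits : deriv p ≈ₚ scaleₚ lead' (prodLinear crit)

-- Write p = c · q and p' = c' · Q with q = ∏ (x - rᵢ) and Q = ∏ (x - sⱼ) monic. Comparing leading
-- coefficients gives c' = d c, hence (k+1) q_{k+1} = b^e Q_k for every k. For k + 1 < d = b^e the
-- integer k + 1 is not divisible by b^e, and since D ∩ ℚ = ℤ divisibility between integers means the
-- same in D as in ℤ; as b is prime, b ∣ q_{k+1}. So q ≡ x^d mod b, and primality of b makes every root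
-- a multiple of b. Then b^(d-k) divides q_k, so b^(e+1) divides b^e Q_j, i.e. b ∣ Q_j, for j < d - 1 - e;
-- the same reduction mod b applied to Q leaves at most e critical points that are not multiples of b.
-- If b ∣ e, also b ∣ Q_(d-1-e), since b ∣ d - e. In that case b^(d-e) ∣ Q_0, so b^d divides q_1, which
-- is ± the product of the d - 1 nonzero roots, all multiples of b; hence one of them is a multiple of b².

module Submission where

open import Algebra.Bundles using (CommutativeRing)
open import Data.Fin using (Fin; zero; suc; punchIn)
import Data.Fin.Properties as Fin
open import Data.Integer using (+_; -[1+_])
open import Data.List using ([]; _∷_)
open import Data.Nat as ℕ using (ℕ; zero; suc; _∸_; NonZero; _<_; _≤_; z≤n; s≤s)
import Data.Nat.Properties as ℕₚ
import Data.Nat.Divisibility as ℕᵈ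
open import Data.Product using (∃; _×_; _,_; proj₁; proj₂)
open import Data.Sum using (_⊎_; inj₁; inj₂; [_,_]′)
import Data.Sum as Sum
open import Data.Vec.Functional using (head; tail; removeAt)
open import Function using (_∘_)
open import Function.Definitions using (Injective)
open import Level using (Level; _⊔_)
open import Relation.Nullary using (¬_; yes; no; contradiction)
open import Relation.Binary.PropositionalEquality as ≡ using (_≡_; _≢_)

-- Defs' divisibility (y ≈ x * q) only appears in the statement; the development uses
-- the standard library's (q * x ≈ y), which comes with its lemmas.
open import Defs hiding (_∣_)
import Defs

1<m^n⇒1<m : ∀ m n → 1 < m ℕ.^ n → 1 < m
1<m^n⇒1<m 0               0       (s≤s ())
1<m^n⇒1<m 0               (suc n) ()
1<m^n⇒1<m 1               n       1<1^n = contradiction 1<1^n (ℕₚ.<-irrefl (≡.sym (ℕₚ.^-zeroˡ n)))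
1<m^n⇒1<m (suc (suc m))   n       _     = s≤s (s≤s z≤n)

n<m^n : ∀ {m} → 1 < m → ∀ n → n < m ℕ.^ n
n<m^n 1<m zero    = s≤s z≤n
n<m^n {m} 1<m (suc n) = ℕₚ.≤-<-trans (n<m^n 1<m n) (ℕₚ.^-monoʳ-< m 1<m (ℕₚ.n<1+n n))

m∸n≤suc[m∸suc[n]] : ∀ m n → m ∸ n ≤ suc (m ∸ suc n)
m∸n≤suc[m∸suc[n]] zero    zero    = z≤n
m∸n≤suc[m∸suc[n]] zero    (suc n) = z≤n
m∸n≤suc[m∸suc[n]] (suc m) zero    = ℕₚ.≤-refl
m∸n≤suc[m∸suc[n]] (suc m) (suc n) = m∸n≤suc[m∸suc[n]] m n

m∸[m∸n]≤n : ∀ m n → m ∸ (m ∸ n) ≤ n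
m∸[m∸n]≤n m n = ℕₚ.m≤n+o⇒m∸n≤o m (m ∸ n) (≡.subst (m ≤_) (ℕₚ.+-comm n (m ∸ n)) (ℕₚ.m≤n+m∸n m n))

m∸1∸[m∸n]≤n∸1 : ∀ m n → m ∸ 1 ∸ (m ∸ n) ≤ n ∸ 1
m∸1∸[m∸n]≤n∸1 zero    zero    = z≤n
m∸1∸[m∸n]≤n∸1 zero    (suc n) = z≤n
m∸1∸[m∸n]≤n∸1 (suc m) zero    = ℕₚ.≤-reflexive (ℕₚ.m≤n⇒m∸n≡0 (ℕₚ.n≤1+n m))
m∸1∸[m∸n]≤n∸1 (suc m) (suc n) = m∸[m∸n]≤n m n

m<n∸o⇒o≤n∸suc[m] : ∀ m n o → m < n ∸ o → o ≤ n ∸ suc m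
m<n∸o⇒o≤n∸suc[m] m n o m<n∸o =
  ℕₚ.m+n≤o⇒m≤o∸n o (≡.subst (_≤ n) (ℕₚ.+-comm (suc m) o) (ℕₚ.m≤o∸n⇒m+n≤o (suc m) o≤n m<n∸o))
  where
  o≤n : o ≤ n
  o≤n = ℕₚ.<⇒≤ (ℕₚ.m∸n≢0⇒n<m (λ n∸o≡0 → ℕₚ.n≮0 (≡.subst (m <_) n∸o≡0 m<n∸o)))

-- A constructive strengthening of AtMost k (¬_ ∘ P): every index is listed or satisfies P.
record AllExceptAtMost {a} {n : ℕ} (k : ℕ) (P : Fin n → Set a) : Set a where
  field
    size                : ℕ
    size≤k              : size ≤ k
    exception           : Fin size → Fin n
    exception-injective : Injective _≡_ _≡_ exception
    exception⊎holds     : ∀ j → (∃ λ i → exception i ≡ j) ⊎ P j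

open AllExceptAtMost

module _ {a : Level} where

  allExcept-everything : ∀ {n} {P : Fin n → Set a} → AllExceptAtMost n P
  allExcept-everything {n} .size                    = n
  allExcept-everything     .size≤k                  = ℕₚ.≤-refl
  allExcept-everything     .exception i             = i
  allExcept-everything     .exception-injective i≡j = i≡j
  allExcept-everything     .exception⊎holds j       = inj₁ (j , ≡.refl)

  allExcept-weaken : ∀ {n k l} {P : Fin n → Set a} → k ≤ l → AllExceptAtMost k P → AllExceptAtMost l P
  allExcept-weaken k≤l A .size                = A .size
  allExcept-weaken k≤l A .size≤k              = ℕₚ.≤-trans (A .size≤k) k≤l
  allExcept-weaken k≤l A .exception           = A .exception
  allExcept-weaken k≤l A .exception-injective = A .exception-injective
  allExcept-weaken k≤l A .exception⊎holds     = A .exception⊎holds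

  allExcept-cons : ∀ {n k} {P : Fin (suc n) → Set a} →
                   P zero → AllExceptAtMost k (P ∘ suc) → AllExceptAtMost k P
  allExcept-cons P₀ A .size                  = A .size
  allExcept-cons P₀ A .size≤k                = A .size≤k
  allExcept-cons P₀ A .exception             = suc ∘ A .exception
  allExcept-cons P₀ A .exception-injective e = A .exception-injective (Fin.suc-injective e)
  allExcept-cons P₀ A .exception⊎holds zero    = inj₂ P₀
  allExcept-cons P₀ A .exception⊎holds (suc j) with A .exception⊎holds j
  ... | inj₁ (i , eᵢ≡j) = inj₁ (i , ≡.cong suc eᵢ≡j)
  ... | inj₂ Pj         = inj₂ Pj

  allExcept-consException : ∀ {n k} {P : Fin (suc n) → Set a} →
                            AllExceptAtMost k (P ∘ suc) → AllExceptAtMost (suc k) P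
  allExcept-consException A .size                 = suc (A .size)
  allExcept-consException A .size≤k               = s≤s (A .size≤k)
  allExcept-consException A .exception zero       = zero
  allExcept-consException A .exception (suc i)    = suc (A .exception i)
  allExcept-consException A .exception-injective {zero}  {zero}  _ = ≡.refl
  allExcept-consException A .exception-injective {suc i} {suc j} e =
    ≡.cong suc (A .exception-injective (Fin.suc-injective e))
  allExcept-consException A .exception⊎holds zero = inj₁ (zero , ≡.refl)
  allExcept-consException A .exception⊎holds (suc j) with A .exception⊎holds j
  ... | inj₁ (i , eᵢ≡j) = inj₁ (suc i , ≡.cong suc eᵢ≡j)
  ... | inj₂ Pj         = inj₂ Pj

  allExcept-none : ∀ {n} {P : Fin n → Set a} → AllExceptAtMost 0 P → ∀ j → P j
  allExcept-none A j with A .exception⊎holds j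
  ... | inj₁ (i , _) = contradiction (≡.subst Fin (ℕₚ.n≤0⇒n≡0 (A .size≤k)) i) Fin.¬Fin0
  ... | inj₂ Pj      = Pj

  allExcept⇒AtMost : ∀ {b n k} {P : Fin n → Set a} {Q : Fin n → Set b} →
                     (∀ {j} → P j → Q j) → AllExceptAtMost k P → AtMost k (λ j → ¬ Q j)
  allExcept⇒AtMost {Q = Q} P⇒Q A = A .size , A .size≤k , A .exception , A .exception-injective , listed
    where
    listed : ∀ j → ¬ Q j → ∃ λ i → A .exception i ≡ j
    listed j ¬Qj with A .exception⊎holds j
    ... | inj₁ listed = listed
    ... | inj₂ Pj     = contradiction (P⇒Q Pj) ¬Qj

module _ {c ℓ} (R : CommutativeRing c ℓ) where

  open CommutativeRing R hiding (zero)
  open import Algebra.Properties.Ring ring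
    using (-‿distribˡ-*; -‿involutive; -0#≈0#; +-cancelˡ; xyx⁻¹≈y; x[y-z]≈xy-xz; x≈y⇒x∙y⁻¹≈ε; x∙y⁻¹≈ε⇒x≈y)
  open import Algebra.Properties.CommutativeSemigroup *-commutativeSemigroup
    using (interchange; x∙yz≈y∙xz; xy∙z≈y∙xz)
  open import Algebra.Properties.Semiring.Divisibility semiring
    using (_∣_; _,_; _∣0; 1∣_; ∣ʳ-trans; ∣ʳ-respʳ-≈; ∣ʳ-respˡ-≈; x∣ʳy⇒x∣ʳzy; x∣ʳy⇒xz∣ʳyz)
  open import Algebra.Properties.CommutativeSemigroup.Divisibility *-commutativeSemigroup
    using (x∣xy; ∙-cong-∣; x∣y⇒zx∣zy)
  open import Algebra.Properties.Semiring.Exp semiring using (_^_; ^-homo-*; ^-congʳ)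
  open import Algebra.Properties.Semiring.Primality semiring using (Prime; mkPrime)
  import Algebra.Properties.Semiring.Mult semiring as Mult
  open import Relation.Binary.Reasoning.Setoid setoid

  ∣-fromDefs : ∀ {x y} → Defs._∣_ R x y → x ∣ y
  ∣-fromDefs {x} (q , y≈xq) = q , trans (*-comm q x) (sym y≈xq)

  ∣-toDefs : ∀ {x y} → x ∣ y → Defs._∣_ R x y
  ∣-toDefs {x} (q , qx≈y) = q , trans (sym qx≈y) (*-comm q x)

  isPrimeElem⇒Prime : ∀ {x} → IsPrimeElem R x → Prime x
  isPrimeElem⇒Prime {x} (x≉0 , x-nonunit , split) =
    mkPrime x≉0 x∤1 (λ {y} {z} x∣yz → Sum.map ∣-fromDefs ∣-fromDefs (split y z (∣-toDefs x∣yz)))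
    where
    x∤1 : ¬ x ∣ 1#
    x∤1 (q , qx≈1) = x-nonunit (q , trans (*-comm x q) qx≈1)

  x∣y∧x∣z⇒x∣y+z : ∀ {x y z} → x ∣ y → x ∣ z → x ∣ y + z
  x∣y∧x∣z⇒x∣y+z {x} (p , px≈y) (q , qx≈z) = p + q , trans (distribʳ x p q) (+-cong px≈y qx≈z)

  x∣y⇒x∣-y : ∀ {x y} → x ∣ y → x ∣ - y
  x∣y⇒x∣-y {x} (p , px≈y) = - p , trans (sym (-‿distribˡ-* p x)) (-‿cong px≈y)

  x∣-y⇒x∣y : ∀ {x y} → x ∣ - y → x ∣ y
  x∣-y⇒x∣y x∣-y = ∣ʳ-respʳ-≈ (-‿involutive _) (x∣y⇒x∣-y x∣-y)

  x∣-y*z⇒x∣y*z : ∀ {x y z} → x ∣ - y * z → x ∣ y * z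
  x∣-y*z⇒x∣y*z {y = y} {z} x∣-yz = x∣-y⇒x∣y (∣ʳ-respʳ-≈ (sym (-‿distribˡ-* y z)) x∣-yz)

  x∣y+z∧x∣y⇒x∣z : ∀ {x y z} → x ∣ y + z → x ∣ y → x ∣ z
  x∣y+z∧x∣y⇒x∣z {y = y} {z} x∣y+z x∣y = ∣ʳ-respʳ-≈ (xyx⁻¹≈y y z) (x∣y∧x∣z⇒x∣y+z x∣y+z (x∣y⇒x∣-y x∣y))

  x∣y+z∧x∣z⇒x∣y : ∀ {x y z} → x ∣ y + z → x ∣ z → x ∣ y
  x∣y+z∧x∣z⇒x∣y {y = y} {z} x∣y+z = x∣y+z∧x∣y⇒x∣z (∣ʳ-respʳ-≈ (+-comm y z) x∣y+z)

  ^-mono-∣ : ∀ x {m n} → m ≤ n → x ^ m ∣ x ^ n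
  ^-mono-∣ x {m} {n} m≤n = x ^ (n ∸ m) , (begin
    x ^ (n ∸ m) * x ^ m    ≈⟨ *-comm _ _ ⟩
    x ^ m * x ^ (n ∸ m)    ≈⟨ ^-homo-* x m (n ∸ m) ⟨
    x ^ (m ℕ.+ (n ∸ m))    ≈⟨ ^-congʳ x (ℕₚ.m+[n∸m]≡n m≤n) ⟩
    x ^ n                  ∎)

  fromℕ≡×1 : ∀ n → fromℕ R n ≡ n Mult.× 1#
  fromℕ≡×1 zero    = ≡.refl
  fromℕ≡×1 (suc n) = ≡.cong (_+_ 1#) (fromℕ≡×1 n)

  fromℕ-+ : ∀ m n → fromℕ R (m ℕ.+ n) ≈ fromℕ R m + fromℕ R n
  fromℕ-+ m n rewrite fromℕ≡×1 (m ℕ.+ n) | fromℕ≡×1 m | fromℕ≡×1 n = Mult.×-homo-+ 1# m n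

  fromℕ-* : ∀ m n → fromℕ R (m ℕ.* n) ≈ fromℕ R m * fromℕ R n
  fromℕ-* m n rewrite fromℕ≡×1 (m ℕ.* n) | fromℕ≡×1 m | fromℕ≡×1 n = Mult.×1-homo-* m n

  fromℕ-^ : ∀ m n → fromℕ R (m ℕ.^ n) ≈ fromℕ R m ^ n
  fromℕ-^ m zero    = +-identityʳ 1#
  fromℕ-^ m (suc n) = trans (fromℕ-* m (m ℕ.^ n)) (*-congˡ (fromℕ-^ m n))

  coeff : Poly R → ℕ → Carrier
  coeff []      _       = 0#
  coeff (a ∷ _) zero    = a
  coeff (_ ∷ f) (suc k) = coeff f k

  coeff-cong : ∀ {f g} → _≈ₚ_ R f g → ∀ k → coeff f k ≈ coeff g k
  coeff-cong []≈[]          _       = refl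
  coeff-cong ([]≈∷ b≈0 _)   zero    = sym b≈0
  coeff-cong ([]≈∷ _ f≈g)   (suc k) = coeff-cong f≈g k
  coeff-cong (∷≈[] a≈0 _)   zero    = a≈0
  coeff-cong (∷≈[] _ f≈g)   (suc k) = coeff-cong f≈g k
  coeff-cong (∷≈∷ a≈b _)    zero    = a≈b
  coeff-cong (∷≈∷ _ f≈g)    (suc k) = coeff-cong f≈g k

  coeff-+ₚ : ∀ f g k → coeff (_+ₚ_ R f g) k ≈ coeff f k + coeff g k
  coeff-+ₚ []      g       k       = sym (+-identityˡ _)
  coeff-+ₚ (a ∷ f) []      k       = sym (+-identityʳ _)
  coeff-+ₚ (a ∷ f) (b ∷ g) zero    = refl
  coeff-+ₚ (a ∷ f) (b ∷ g) (suc k) = coeff-+ₚ f g k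

  coeff-scaleₚ : ∀ a f k → coeff (scaleₚ R a f) k ≈ a * coeff f k
  coeff-scaleₚ a []      k       = sym (zeroʳ a)
  coeff-scaleₚ a (b ∷ f) zero    = refl
  coeff-scaleₚ a (b ∷ f) (suc k) = coeff-scaleₚ a f k

  coeff-*ₚ-∷ : ∀ a f g k → coeff (_*ₚ_ R (a ∷ f) g) k ≈ a * coeff g k + coeff (0# ∷ _*ₚ_ R f g) k
  coeff-*ₚ-∷ a f g k = trans (coeff-+ₚ (scaleₚ R a g) _ k) (+-congʳ (coeff-scaleₚ a g k))

  coeff-1*ₚ : ∀ g k → coeff (_*ₚ_ R (1# ∷ []) g) k ≈ coeff g k
  coeff-1*ₚ g k = begin
    coeff (_*ₚ_ R (1# ∷ []) g) k        ≈⟨ coeff-*ₚ-∷ 1# [] g k ⟩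
    1# * coeff g k + coeff (0# ∷ []) k  ≈⟨ +-cong (*-identityˡ _) (coeff-0∷[] k) ⟩
    coeff g k + 0#                      ≈⟨ +-identityʳ _ ⟩
    coeff g k                           ∎
    where
    coeff-0∷[] : ∀ k → coeff (0# ∷ []) k ≈ 0#
    coeff-0∷[] zero    = refl
    coeff-0∷[] (suc k) = refl

  coeff-linear-*ₚ : ∀ a g k → coeff (_*ₚ_ R (linear R a) g) k ≈ - a * coeff g k + coeff (0# ∷ g) k
  coeff-linear-*ₚ a g zero    = coeff-*ₚ-∷ (- a) (1# ∷ []) g zero
  coeff-linear-*ₚ a g (suc k) = trans (coeff-*ₚ-∷ (- a) (1# ∷ []) g (suc k)) (+-congˡ (coeff-1*ₚ g k))

  coeff-derivAux : ∀ j f k → coeff (derivAux R j f) k ≈ fromℕ R (j ℕ.+ k) * coeff f k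
  coeff-derivAux j []      k       = sym (zeroʳ _)
  coeff-derivAux j (a ∷ f) zero    = *-congʳ (reflexive (≡.cong (fromℕ R) (≡.sym (ℕₚ.+-identityʳ j))))
  coeff-derivAux j (a ∷ f) (suc k) =
    trans (coeff-derivAux (suc j) f k) (*-congʳ (reflexive (≡.cong (fromℕ R) (≡.sym (ℕₚ.+-suc j k)))))

  coeff-deriv : ∀ f k → coeff (deriv R f) k ≈ fromℕ R (suc k) * coeff f (suc k)
  coeff-deriv []      k = sym (zeroʳ _)
  coeff-deriv (a ∷ f) k = coeff-derivAux 1 f k

  x≈0⇒-x*y≈0 : ∀ {x} y → x ≈ 0# → - x * y ≈ 0#
  x≈0⇒-x*y≈0 y x≈0 = trans (*-congʳ (trans (-‿cong x≈0) -0#≈0#)) (zeroˡ y)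

  coeff-prodLinear : ∀ {n} (xs : Fin (suc n) → Carrier) k →
                     coeff (prodLinear R xs) k ≈
                     - head xs * coeff (prodLinear R (tail xs)) k + coeff (0# ∷ prodLinear R (tail xs)) k
  coeff-prodLinear xs = coeff-linear-*ₚ (head xs) (prodLinear R (tail xs))

  coeff₀-prodLinear : ∀ {n} (xs : Fin (suc n) → Carrier) →
                      coeff (prodLinear R xs) 0 ≈ - head xs * coeff (prodLinear R (tail xs)) 0
  coeff₀-prodLinear xs = trans (coeff-prodLinear xs 0) (+-identityʳ _)

  coeff-prodLinear-> : ∀ {n} (xs : Fin n → Carrier) {k} → n < k → coeff (prodLinear R xs) k ≈ 0#
  coeff-prodLinear-> {zero}  xs {suc k} _          = refl
  coeff-prodLinear-> {suc n} xs {suc k} (s≤s n<k) = begin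
    coeff (prodLinear R xs) (suc k)
      ≈⟨ coeff-prodLinear xs (suc k) ⟩
    - head xs * coeff (prodLinear R (tail xs)) (suc k) + coeff (prodLinear R (tail xs)) k
      ≈⟨ +-cong (*-congˡ (coeff-prodLinear-> (tail xs) (ℕₚ.m<n⇒m<1+n n<k)))
                (coeff-prodLinear-> (tail xs) n<k) ⟩
    - head xs * 0# + 0#
      ≈⟨ trans (+-identityʳ _) (zeroʳ _) ⟩
    0# ∎

  coeff-prodLinear-lead : ∀ {n} (xs : Fin n → Carrier) → coeff (prodLinear R xs) n ≈ 1#
  coeff-prodLinear-lead {zero}  xs = refl
  coeff-prodLinear-lead {suc n} xs = begin
    coeff (prodLinear R xs) (suc n)
      ≈⟨ coeff-prodLinear xs (suc n) ⟩
    - head xs * coeff (prodLinear R (tail xs)) (suc n) + coeff (prodLinear R (tail xs)) n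
      ≈⟨ +-cong (*-congˡ (coeff-prodLinear-> (tail xs) (ℕₚ.n<1+n n))) (coeff-prodLinear-lead (tail xs)) ⟩
    - head xs * 0# + 1#
      ≈⟨ trans (+-congʳ (zeroʳ _)) (+-identityˡ 1#) ⟩
    1# ∎

  coeff₀-prodLinear-zeroRoot : ∀ {n} (xs : Fin n → Carrier) i → xs i ≈ 0# → coeff (prodLinear R xs) 0 ≈ 0#
  coeff₀-prodLinear-zeroRoot {suc n} xs zero    x₀≈0 = trans (coeff₀-prodLinear xs) (x≈0⇒-x*y≈0 _ x₀≈0)
  coeff₀-prodLinear-zeroRoot {suc n} xs (suc i) xᵢ≈0 =
    trans (coeff₀-prodLinear xs) (trans (*-congˡ (coeff₀-prodLinear-zeroRoot (tail xs) i xᵢ≈0)) (zeroʳ _))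

  coeff-prodLinear-removeAt : ∀ {n} (xs : Fin (suc n) → Carrier) i → xs i ≈ 0# → ∀ k →
                              coeff (prodLinear R xs) (suc k) ≈ coeff (prodLinear R (removeAt xs i)) k
  coeff-prodLinear-removeAt xs zero x₀≈0 k =
    trans (coeff-prodLinear xs (suc k)) (trans (+-congʳ (x≈0⇒-x*y≈0 _ x₀≈0)) (+-identityˡ _))
  coeff-prodLinear-removeAt {suc n} xs (suc i) xᵢ≈0 k = begin
    coeff (prodLinear R xs) (suc k)              ≈⟨ coeff-prodLinear xs (suc k) ⟩
    - head xs * coeff t (suc k) + coeff t k      ≈⟨ +-cong (*-congˡ (IH k)) (shifted k) ⟩
    - head xs * coeff s k + coeff (0# ∷ s) k     ≈⟨ coeff-prodLinear (removeAt xs (suc i)) k ⟨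
    coeff (prodLinear R (removeAt xs (suc i))) k ∎
    where
    t s : Poly R
    t = prodLinear R (tail xs)
    s = prodLinear R (removeAt (tail xs) i)
    IH : ∀ k → coeff t (suc k) ≈ coeff s k
    IH = coeff-prodLinear-removeAt (tail xs) i xᵢ≈0
    shifted : ∀ k → coeff t k ≈ coeff (0# ∷ s) k
    shifted zero    = coeff₀-prodLinear-zeroRoot (tail xs) i xᵢ≈0
    shifted (suc k) = IH k

  ^-∣-coeff-prodLinear : ∀ {x n} (xs : Fin n → Carrier) → (∀ i → x ∣ xs i) →
                         ∀ k → x ^ (n ∸ k) ∣ coeff (prodLinear R xs) k
  ^-∣-coeff-prodLinear {n = zero}  xs _    zero    = 1∣ _
  ^-∣-coeff-prodLinear {n = zero}  xs _    (suc k) = 1∣ _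
  ^-∣-coeff-prodLinear {n = suc n} xs x∣xs zero    =
    ∣ʳ-respʳ-≈ (sym (coeff₀-prodLinear xs))
      (∙-cong-∣ (x∣y⇒x∣-y (x∣xs zero)) (^-∣-coeff-prodLinear (tail xs) (x∣xs ∘ suc) zero))
  ^-∣-coeff-prodLinear {x} {suc n} xs x∣xs (suc k) =
    ∣ʳ-respʳ-≈ (sym (coeff-prodLinear xs (suc k)))
      (x∣y∧x∣z⇒x∣y+z
        (∣ʳ-trans (^-mono-∣ x (m∸n≤suc[m∸suc[n]] n k))
                  (∙-cong-∣ (x∣y⇒x∣-y (x∣xs zero)) (^-∣-coeff-prodLinear (tail xs) (x∣xs ∘ suc) (suc k))))
        (^-∣-coeff-prodLinear (tail xs) (x∣xs ∘ suc) k))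

  module IntegralDomain (dom : IsIntegralDomain R) where

    *-cancelˡ : ∀ {x y z} → x ≉ 0# → x * y ≈ x * z → y ≈ z
    *-cancelˡ {x} {y} {z} x≉0 xy≈xz
      with proj₂ dom x (y - z) (trans (x[y-z]≈xy-xz x y z) (x≈y⇒x∙y⁻¹≈ε xy≈xz))
    ... | inj₁ x≈0   = contradiction x≈0 x≉0
    ... | inj₂ y-z≈0 = x∙y⁻¹≈ε⇒x≈y y z y-z≈0

    x^n≉0 : ∀ {x} → x ≉ 0# → ∀ n → x ^ n ≉ 0#
    x^n≉0 x≉0 zero    = proj₁ dom
    x^n≉0 x≉0 (suc n) = [ x≉0 , x^n≉0 x≉0 n ]′ ∘ proj₂ dom _ _

    ∣-cancelˡ : ∀ {x y z} → x ≉ 0# → x * y ∣ x * z → y ∣ z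
    ∣-cancelˡ {x} {y} x≉0 (q , q[xy]≈xz) = q , *-cancelˡ x≉0 (trans (x∙yz≈y∙xz x q y) q[xy]≈xz)

    x^[1+n]∣x^n*y⇒x∣y : ∀ {x y} → x ≉ 0# → ∀ n → x ^ suc n ∣ x ^ n * y → x ∣ y
    x^[1+n]∣x^n*y⇒x∣y {x} x≉0 n h = ∣-cancelˡ (x^n≉0 x≉0 n) (∣ʳ-respˡ-≈ (*-comm x (x ^ n)) h)

  module _ (cz : CharZero R) where

    fromℕ-injective : ∀ {m n} → fromℕ R m ≈ fromℕ R n → m ≡ n
    fromℕ-injective {zero}  {zero}  _ = ≡.refl
    fromℕ-injective {zero}  {suc n} 0≈n = contradiction (sym 0≈n) (cz (suc n) (λ ()))
    fromℕ-injective {suc m} {zero}  m≈0 = contradiction m≈0 (cz (suc m) (λ ()))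
    fromℕ-injective {suc m} {suc n} m≈n = ≡.cong suc (fromℕ-injective (+-cancelˡ 1# _ _ m≈n))

    -- The quotient k / b lies in D ∩ ℚ = ℤ, and it is not negative since D has characteristic zero.
    fromℕ-∣⇒∣ : IntersectQIsZ R → ∀ {b k} → b ≢ 0 → fromℕ R b ∣ fromℕ R k → b ℕᵈ.∣ k
    fromℕ-∣⇒∣ iq {b} {k} b≢0 (y , yb≈k) with iq y (+ k) b b≢0 (trans (*-comm _ y) yb≈k)
    ... | + n , y≈n = ℕᵈ.divides n (fromℕ-injective (begin
      fromℕ R k             ≈⟨ yb≈k ⟨
      y * fromℕ R b         ≈⟨ *-congʳ y≈n ⟩
      fromℕ R n * fromℕ R b ≈⟨ fromℕ-* n b ⟨
      fromℕ R (n ℕ.* b)     ∎))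
    ... | -[1+ n ] , y≈-[1+n] = contradiction (begin
      fromℕ R (k ℕ.+ suc n ℕ.* b)               ≈⟨ fromℕ-+ k (suc n ℕ.* b) ⟩
      fromℕ R k + fromℕ R (suc n ℕ.* b)         ≈⟨ +-cong (sym yb≈k) (fromℕ-* (suc n) b) ⟩
      y * fromℕ R b + fromℕ R (suc n) * fromℕ R b ≈⟨ distribʳ _ y _ ⟨
      (y + fromℕ R (suc n)) * fromℕ R b         ≈⟨ *-congʳ (+-congʳ y≈-[1+n]) ⟩
      (- fromℕ R (suc n) + fromℕ R (suc n)) * fromℕ R b ≈⟨ *-congʳ (-‿inverseˡ _) ⟩
      0# * fromℕ R b                            ≈⟨ zeroˡ _ ⟩
      0#                                        ∎) (cz (k ℕ.+ suc n ℕ.* b) k+[1+n]b≢0)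
      where
      k+[1+n]b≢0 : k ℕ.+ suc n ℕ.* b ≢ 0
      k+[1+n]b≢0 eq = b≢0 (ℕₚ.m+n≡0⇒m≡0 b (ℕₚ.m+n≡0⇒n≡0 k eq))

  module PrimeElement (dom : IsIntegralDomain R) {B : Carrier} (B-prime : Prime B) where

    open IntegralDomain dom
    open Prime B-prime

    CoeffsDivisibleBelow : ℕ → Poly R → Set (c ⊔ ℓ)
    CoeffsDivisibleBelow m f = ∀ k → k < m → B ∣ coeff f k

    coeffsBelow-suc : ∀ {m f} → CoeffsDivisibleBelow m f → B ∣ coeff f m → CoeffsDivisibleBelow (suc m) f
    coeffsBelow-suc h B∣fₘ k k<1+m with ℕₚ.m<1+n⇒m<n∨m≡n k<1+m
    ... | inj₁ k<m    = h k k<m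
    ... | inj₂ ≡.refl = B∣fₘ

    coeffsBelow-shift : ∀ {m f} → CoeffsDivisibleBelow m f → B ∣ coeff (0# ∷ f) m
    coeffsBelow-shift {zero}  _ = B ∣0
    coeffsBelow-shift {suc m} h = h m (ℕₚ.n<1+n m)

    coeffsBelow⇒≤ : ∀ {n m} (xs : Fin n → Carrier) → CoeffsDivisibleBelow m (prodLinear R xs) → m ≤ n
    coeffsBelow⇒≤ {n} {m} xs h with m ℕₚ.≤? n
    ... | yes m≤n = m≤n
    ... | no  m≰n = contradiction (∣ʳ-respʳ-≈ (coeff-prodLinear-lead xs) (h n (ℕₚ.≰⇒> m≰n))) p∤1

    -- Mod B: if x^m divides (x - head xs) · ∏ (x - tail xs j) and B ∤ head xs, x^m divides the second factor.
    ∣head⊎coeffsBelow-tail : ∀ {n} (xs : Fin (suc n) → Carrier) m →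
                             CoeffsDivisibleBelow m (prodLinear R xs) →
                             B ∣ head xs ⊎ CoeffsDivisibleBelow m (prodLinear R (tail xs))
    ∣head⊎coeffsBelow-tail xs zero    _ = inj₂ (λ _ ())
    ∣head⊎coeffsBelow-tail xs (suc m) h with ∣head⊎coeffsBelow-tail xs m (λ k k<m → h k (ℕₚ.m<n⇒m<1+n k<m))
    ... | inj₁ B∣x₀ = inj₁ B∣x₀
    ... | inj₂ h′ with split-∣ (x∣-y*z⇒x∣y*z (x∣y+z∧x∣z⇒x∣y
                      (∣ʳ-respʳ-≈ (coeff-prodLinear xs m) (h m (ℕₚ.n<1+n m))) (coeffsBelow-shift h′)))
    ...   | inj₁ B∣x₀ = inj₁ B∣x₀
    ...   | inj₂ B∣tₘ = inj₂ (coeffsBelow-suc {f = prodLinear R (tail xs)} h′ B∣tₘ)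

    coeffsBelow-dropRoot : ∀ {n} (xs : Fin (suc n) → Carrier) {m} → B ∣ head xs →
                           CoeffsDivisibleBelow (suc m) (prodLinear R xs) →
                           CoeffsDivisibleBelow m (prodLinear R (tail xs))
    coeffsBelow-dropRoot xs B∣x₀ h k k<m =
      x∣y+z∧x∣y⇒x∣z (∣ʳ-respʳ-≈ (coeff-prodLinear xs (suc k)) (h (suc k) (s≤s k<m)))
                    (∣ʳ-trans (x∣y⇒x∣-y B∣x₀) (x∣xy _ _))

    rootsDivisibleExceptAtMost : ∀ {n} (xs : Fin n → Carrier) m → CoeffsDivisibleBelow m (prodLinear R xs) →
                                 AllExceptAtMost (n ∸ m) (λ j → B ∣ xs j) × B ^ m ∣ coeff (prodLinear R xs) 0
    rootsDivisibleExceptAtMost         xs zero    _ = allExcept-everything , 1∣ _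
    rootsDivisibleExceptAtMost {zero}  xs (suc m) h = contradiction (h 0 (s≤s z≤n)) p∤1
    rootsDivisibleExceptAtMost {suc n} xs (suc m) h with ∣head⊎coeffsBelow-tail xs (suc m) h
    ... | inj₁ B∣x₀ =
      let A , Bᵐ∣t₀ = rootsDivisibleExceptAtMost (tail xs) m (coeffsBelow-dropRoot xs B∣x₀ h)
      in  allExcept-cons B∣x₀ A ,
          ∣ʳ-respʳ-≈ (sym (coeff₀-prodLinear xs)) (∙-cong-∣ (x∣y⇒x∣-y B∣x₀) Bᵐ∣t₀)
    ... | inj₂ h′ =
      let A , Bᵐ∣t₀ = rootsDivisibleExceptAtMost (tail xs) (suc m) h′
      in  allExcept-weaken (ℕₚ.≤-reflexive (≡.sym (ℕₚ.+-∸-assoc 1 (coeffsBelow⇒≤ (tail xs) h′))))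
                           (allExcept-consException A) ,
          ∣ʳ-respʳ-≈ (sym (coeff₀-prodLinear xs)) (x∣ʳy⇒x∣ʳzy (- head xs) Bᵐ∣t₀)

    square∣⊎pow∣ : ∀ {x y} n → B ∣ x → B ^ n ∣ y → B ^ suc (suc n) ∣ x * y → B * B ∣ x ⊎ B ^ suc n ∣ y
    square∣⊎pow∣ {x} {y} n (u , uB≈x) (w , wBⁿ≈y) h
      with split-∣ (x^[1+n]∣x^n*y⇒x∣y p≉0 (suc n) (∣ʳ-respʳ-≈ xy≈Bⁿ⁺¹uw h))
      where
      xy≈Bⁿ⁺¹uw : x * y ≈ B ^ suc n * (u * w)
      xy≈Bⁿ⁺¹uw = begin
        x * y                  ≈⟨ *-cong uB≈x wBⁿ≈y ⟨
        (u * B) * (w * B ^ n)  ≈⟨ interchange u B w (B ^ n) ⟩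
        (u * w) * B ^ suc n    ≈⟨ *-comm _ _ ⟩
        B ^ suc n * (u * w)    ∎
    ... | inj₁ B∣u = inj₁ (∣ʳ-respʳ-≈ uB≈x (x∣ʳy⇒xz∣ʳyz B B∣u))
    ... | inj₂ B∣w = inj₂ (∣ʳ-respʳ-≈ wBⁿ≈y (x∣ʳy⇒xz∣ʳyz (B ^ n) B∣w))

    pow∣coeff₀⇒square∣root : ∀ {n} (xs : Fin n → Carrier) → (∀ i → B ∣ xs i) →
                             B ^ suc n ∣ coeff (prodLinear R xs) 0 → ∃ λ i → B * B ∣ xs i
    pow∣coeff₀⇒square∣root {zero}  xs _    h = contradiction (∣ʳ-trans (x∣xy B 1#) h) p∤1
    pow∣coeff₀⇒square∣root {suc n} xs B∣xs h
      with square∣⊎pow∣ n (x∣y⇒x∣-y (B∣xs zero)) (^-∣-coeff-prodLinear (tail xs) (B∣xs ∘ suc) 0)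
                          (∣ʳ-respʳ-≈ (coeff₀-prodLinear xs) h)
    ... | inj₁ B²∣-x₀ = zero , x∣-y⇒x∣y B²∣-x₀
    ... | inj₂ Bⁿ⁺¹∣t₀ =
      let i , B²∣xᵢ = pow∣coeff₀⇒square∣root (tail xs) (B∣xs ∘ suc) Bⁿ⁺¹∣t₀ in suc i , B²∣xᵢ

    pow∣coeff₁⇒square∣nonzeroRoot : ∀ {n} (xs : Fin n → Carrier) → (∀ i → B ∣ xs i) →
                                    ∀ i → xs i ≈ 0# → (∀ i j → xs i ≈ 0# → xs j ≈ 0# → i ≡ j) →
                                    B ^ n ∣ coeff (prodLinear R xs) 1 → ∃ λ j → xs j ≉ 0# × B * B ∣ xs j
    pow∣coeff₁⇒square∣nonzeroRoot {suc n} xs B∣xs i xᵢ≈0 simple h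
      with pow∣coeff₀⇒square∣root (removeAt xs i) (B∣xs ∘ punchIn i)
                                  (∣ʳ-respʳ-≈ (coeff-prodLinear-removeAt xs i xᵢ≈0 0) h)
    ... | j , B²∣xⱼ = punchIn i j , (λ xⱼ≈0 → Fin.punchInᵢ≢i i j (simple _ _ xⱼ≈0 xᵢ≈0)) , B²∣xⱼ

  module _ (dom : IsIntegralDomain R) (cz : CharZero R) (iq : IntersectQIsZ R)
           {b : ℕ} (b-prime : Prime (fromℕ R b)) where

    open IntegralDomain dom
    open Prime b-prime

    private
      b≢0 : b ≢ 0
      b≢0 ≡.refl = p≉0 refl

    -- Peel off factors b one at a time: each divides a or k by primality, and k has fewer than s of them.
    fromℕ^-∣-fromℕ*⇒∣ : ∀ s k {a} → ¬ (b ℕ.^ s ℕᵈ.∣ k) → fromℕ R b ^ s ∣ fromℕ R k * a → fromℕ R b ∣ a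
    fromℕ^-∣-fromℕ*⇒∣ zero    k bˢ∤k _ = contradiction (ℕᵈ.1∣ k) bˢ∤k
    fromℕ^-∣-fromℕ*⇒∣ (suc s) k {a} bˢ⁺¹∤k h with split-∣ (∣ʳ-trans (x∣xy (fromℕ R b) _) h)
    ... | inj₂ b∣a = b∣a
    ... | inj₁ b∣k with fromℕ-∣⇒∣ cz iq b≢0 b∣k
    ...   | ℕᵈ.divides k′ k≡k′b = fromℕ^-∣-fromℕ*⇒∣ s k′ bˢ∤k′ (∣-cancelˡ p≉0 (∣ʳ-respʳ-≈ k*a≈b*[k′*a] h))
      where
      bˢ∤k′ : ¬ (b ℕ.^ s ℕᵈ.∣ k′)
      bˢ∤k′ bˢ∣k′ = bˢ⁺¹∤k (≡.subst (b ℕ.^ suc s ℕᵈ.∣_) (≡.sym (≡.trans k≡k′b (ℕₚ.*-comm k′ b)))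
                                   (ℕᵈ.*-monoʳ-∣ b bˢ∣k′))
      k*a≈b*[k′*a] : fromℕ R k * a ≈ fromℕ R b * (fromℕ R k′ * a)
      k*a≈b*[k′*a] = begin
        fromℕ R k * a                  ≈⟨ *-congʳ (reflexive (≡.cong (fromℕ R) k≡k′b)) ⟩
        fromℕ R (k′ ℕ.* b) * a         ≈⟨ *-congʳ (fromℕ-* k′ b) ⟩
        fromℕ R k′ * fromℕ R b * a     ≈⟨ xy∙z≈y∙xz _ _ a ⟩
        fromℕ R b * (fromℕ R k′ * a)   ∎

  module _ (dom : IsIntegralDomain R) {p : Poly R} {d : ℕ} (N : Nice R p d) where

    open IntegralDomain dom
    open Nice N

    private
      coeff-deriv-split : ∀ k → fromℕ R (suc k) * (lead * coeff (prodLinear R roots) (suc k)) ≈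
                                lead' * coeff (prodLinear R crit) k
      coeff-deriv-split k = begin
        fromℕ R (suc k) * (lead * coeff (prodLinear R roots) (suc k))
          ≈⟨ *-congˡ (trans (coeff-cong p-splits (suc k)) (coeff-scaleₚ lead (prodLinear R roots) (suc k))) ⟨
        fromℕ R (suc k) * coeff p (suc k)
          ≈⟨ coeff-deriv p k ⟨
        coeff (deriv R p) k
          ≈⟨ trans (coeff-cong p'-splits k) (coeff-scaleₚ lead' (prodLinear R crit) k) ⟩
        lead' * coeff (prodLinear R crit) k ∎

    lead'≈d*lead : lead' ≈ fromℕ R d * lead
    lead'≈d*lead = begin
      lead'
        ≈⟨ trans (*-congˡ (coeff-prodLinear-lead crit)) (*-identityʳ lead') ⟨
      lead' * coeff (prodLinear R crit) (d ∸ 1)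
        ≈⟨ coeff-deriv-split (d ∸ 1) ⟨
      fromℕ R (suc (d ∸ 1)) * (lead * coeff (prodLinear R roots) (suc (d ∸ 1)))
        ≡⟨ ≡.cong (λ n → fromℕ R n * (lead * coeff (prodLinear R roots) n))
                  (ℕₚ.m+[n∸m]≡n (ℕₚ.<⇒≤ two≤d)) ⟩
      fromℕ R d * (lead * coeff (prodLinear R roots) d)
        ≈⟨ *-congˡ (trans (*-congˡ (coeff-prodLinear-lead roots)) (*-identityʳ lead)) ⟩
      fromℕ R d * lead ∎

    coeff-deriv-monic : ∀ k → fromℕ R (suc k) * coeff (prodLinear R roots) (suc k) ≈
                              fromℕ R d * coeff (prodLinear R crit) k
    coeff-deriv-monic k = *-cancelˡ lead≉0 (begin
      lead * (fromℕ R (suc k) * coeff (prodLinear R roots) (suc k))  ≈⟨ x∙yz≈y∙xz _ _ _ ⟩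
      fromℕ R (suc k) * (lead * coeff (prodLinear R roots) (suc k))  ≈⟨ coeff-deriv-split k ⟩
      lead' * coeff (prodLinear R crit) k                            ≈⟨ *-congʳ lead'≈d*lead ⟩
      fromℕ R d * lead * coeff (prodLinear R crit) k                 ≈⟨ xy∙z≈y∙xz _ _ _ ⟩
      lead * (fromℕ R d * coeff (prodLinear R crit) k)               ∎)

  module PrimePowerDegree (dom : IsIntegralDomain R) (cz : CharZero R) (iq : IntersectQIsZ R)
    {b e : ℕ} (0<e : 0 < e) (b-prime : Prime (fromℕ R b))
    {p : Poly R} (N : Nice R p (b ℕ.^ e)) {i₀ : Fin (b ℕ.^ e)} (root₀ : Nice.roots N i₀ ≈ 0#) where

    open IntegralDomain dom
    open PrimeElement dom b-prime
    open Prime b-prime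
    open Nice N

    B : Carrier
    B = fromℕ R b

    d : ℕ
    d = b ℕ.^ e

    q Q : Poly R
    q = prodLinear R roots
    Q = prodLinear R crit

    e<d : e < d
    e<d = n<m^n (1<m^n⇒1<m b e two≤d) e

    coeff-q≈Bᵉ*coeff-Q : ∀ k → fromℕ R (suc k) * coeff q (suc k) ≈ B ^ e * coeff Q k
    coeff-q≈Bᵉ*coeff-Q k = trans (coeff-deriv-monic dom N k) (*-congʳ (fromℕ-^ b e))

    q-coeffsBelow-d : CoeffsDivisibleBelow d q
    q-coeffsBelow-d zero    _     = ∣ʳ-respʳ-≈ (sym (coeff₀-prodLinear-zeroRoot roots i₀ root₀)) (B ∣0)
    q-coeffsBelow-d (suc k) 1+k<d =
      fromℕ^-∣-fromℕ*⇒∣ dom cz iq b-prime e (suc k) (ℕᵈ.>⇒∤ 1+k<d)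
        (∣ʳ-respʳ-≈ (sym (coeff-q≈Bᵉ*coeff-Q k)) (x∣xy (B ^ e) (coeff Q k)))

    roots-divisible : ∀ i → B ∣ roots i
    roots-divisible = allExcept-none (allExcept-weaken (ℕₚ.≤-reflexive (ℕₚ.n∸n≡0 d))
                                        (proj₁ (rootsDivisibleExceptAtMost roots d q-coeffsBelow-d)))

    -- As all roots are multiples of B, the coefficient of x^(j+1) in q is divisible by B^(d-j-1).
    coeff-Q-divisible : ∀ j → e < d ∸ suc j → B ∣ coeff Q j
    coeff-Q-divisible j e<d∸[1+j] =
      x^[1+n]∣x^n*y⇒x∣y p≉0 e (∣ʳ-respʳ-≈ (coeff-q≈Bᵉ*coeff-Q j)
        (x∣ʳy⇒x∣ʳzy (fromℕ R (suc j))
          (∣ʳ-trans (^-mono-∣ B e<d∸[1+j]) (^-∣-coeff-prodLinear roots roots-divisible (suc j)))))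

    crit-divisibleExceptAtMost-e : AllExceptAtMost e (λ j → B ∣ crit j)
    crit-divisibleExceptAtMost-e =
      allExcept-weaken (m∸1∸[m∸n]≤n∸1 d (suc e))
        (proj₁ (rootsDivisibleExceptAtMost crit (d ∸ suc e)
                  (λ j j<d∸[1+e] → coeff-Q-divisible j (m<n∸o⇒o≤n∸suc[m] j d (suc e) j<d∸[1+e]))))

    module _ (B∣e : B ∣ fromℕ R e) where

      -- At the one index j = d - e - 1 not covered above, both B ∣ j + 1 = d - e and B^e ∣ coeff q (j+1).
      Q-coeffsBelow-d∸e : CoeffsDivisibleBelow (d ∸ e) Q
      Q-coeffsBelow-d∸e j j<d∸e with ℕₚ.m≤n⇒m<n∨m≡n (m<n∸o⇒o≤n∸suc[m] j d e j<d∸e)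
      ... | inj₁ e<d∸[1+j] = coeff-Q-divisible j e<d∸[1+j]
      ... | inj₂ e≡d∸[1+j] =
        x^[1+n]∣x^n*y⇒x∣y p≉0 e (∣ʳ-respʳ-≈ (coeff-q≈Bᵉ*coeff-Q j) (∙-cong-∣ B∣1+j Bᵉ∣qⱼ₊₁))
        where
        Bᵉ∣qⱼ₊₁ : B ^ e ∣ coeff q (suc j)
        Bᵉ∣qⱼ₊₁ = ≡.subst (λ s → B ^ s ∣ coeff q (suc j)) (≡.sym e≡d∸[1+j])
                          (^-∣-coeff-prodLinear roots roots-divisible (suc j))
        1+j+e≡d : suc j ℕ.+ e ≡ d
        1+j+e≡d = ≡.trans (≡.cong (suc j ℕ.+_) e≡d∸[1+j]) (ℕₚ.m+[n∸m]≡n (ℕₚ.≤-trans j<d∸e (ℕₚ.m∸n≤m d e)))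
        B∣d : B ∣ fromℕ R d
        B∣d = ∣ʳ-respʳ-≈ (sym (fromℕ-^ b e)) (∣ʳ-respˡ-≈ (*-identityʳ B) (^-mono-∣ B 0<e))
        B∣1+j : B ∣ fromℕ R (suc j)
        B∣1+j = x∣y+z∧x∣z⇒x∣y
                  (∣ʳ-respʳ-≈ (trans (reflexive (≡.cong (fromℕ R) (≡.sym 1+j+e≡d))) (fromℕ-+ (suc j) e)) B∣d)
                  B∣e

      crit-divisibleExceptAtMost-e∸1 : AllExceptAtMost (e ∸ 1) (λ j → B ∣ crit j)
      crit-divisibleExceptAtMost-e∸1 =
        allExcept-weaken (m∸1∸[m∸n]≤n∸1 d e)
          (proj₁ (rootsDivisibleExceptAtMost crit (d ∸ e) Q-coeffsBelow-d∸e))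

      nonzeroRoot-square∣ : (∀ i j → roots i ≈ 0# → roots j ≈ 0# → i ≡ j) →
                            ∃ λ i → roots i ≉ 0# × B * B ∣ roots i
      nonzeroRoot-square∣ simple =
        pow∣coeff₁⇒square∣nonzeroRoot roots roots-divisible i₀ root₀ simple Bᵈ∣q₁
        where
        q₁≈Bᵉ*Q₀ : coeff q 1 ≈ B ^ e * coeff Q 0
        q₁≈Bᵉ*Q₀ = trans (sym (trans (*-congʳ (+-identityʳ 1#)) (*-identityˡ _))) (coeff-q≈Bᵉ*coeff-Q 0)
        Bᵉ*Bᵈ⁻ᵉ≈Bᵈ : B ^ e * B ^ (d ∸ e) ≈ B ^ d
        Bᵉ*Bᵈ⁻ᵉ≈Bᵈ = trans (sym (^-homo-* B e (d ∸ e))) (^-congʳ B (ℕₚ.m+[n∸m]≡n (ℕₚ.<⇒≤ e<d)))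
        Bᵈ∣q₁ : B ^ d ∣ coeff q 1
        Bᵈ∣q₁ = ∣ʳ-respˡ-≈ Bᵉ*Bᵈ⁻ᵉ≈Bᵈ (∣ʳ-respʳ-≈ (sym q₁≈Bᵉ*Q₀)
                  (x∣y⇒zx∣zy (B ^ e) (proj₂ (rootsDivisibleExceptAtMost crit (d ∸ e) Q-coeffsBelow-d∸e))))

-- Kept out of scope above, where they would clash with the ring's _^_ and the library's _∣_.
open import Data.Nat using (_^_)
open import Defs using (_∣_)

theorem6p3 : ∀ {c ℓ} (D : CommutativeRing c ℓ) →
    IsUFD D → CharZero D → IntersectQIsZ D →
    (b e : ℕ) → NonZero b → NonZero e →
    IsPrimeElem D (fromℕ D b) →
    (p : Poly D) → (N : Nice D p (b ^ e)) →
    (∃ λ i → CommutativeRing._≈_ D (Nice.roots N i) (CommutativeRing.0# D)) →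
    -- (a)
    (∀ i → _∣_ D (fromℕ D b) (Nice.roots N i))
    -- (b)
    × AtMost e (λ j → ¬ _∣_ D (fromℕ D b) (Nice.crit N j))
    -- (c)
    × ((∀ i j → CommutativeRing._≈_ D (Nice.roots N i) (CommutativeRing.0# D) →
                CommutativeRing._≈_ D (Nice.roots N j) (CommutativeRing.0# D) → i ≡ j) →
       _∣_ D (fromℕ D b) (fromℕ D e) →
       -- (c1)
       (∃ λ i → ¬ CommutativeRing._≈_ D (Nice.roots N i) (CommutativeRing.0# D)
              × _∣_ D (CommutativeRing._*_ D (fromℕ D b) (fromℕ D b)) (Nice.roots N i))
       -- (c2)
       × AtMost (e ∸ 1) (λ j → ¬ _∣_ D (fromℕ D b) (Nice.crit N j)))
theorem6p3 D ufd cz iq b e _ nonZero-e prime p N (i₀ , root₀) =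
    ∣-toDefs D ∘ roots-divisible
  , allExcept⇒AtMost (∣-toDefs D) crit-divisibleExceptAtMost-e
  , λ simple B∣e →
      let i , rootᵢ≉0 , B²∣rootᵢ = nonzeroRoot-square∣ (∣-fromDefs D B∣e) simple
      in  (i , rootᵢ≉0 , ∣-toDefs D B²∣rootᵢ)
        , allExcept⇒AtMost (∣-toDefs D) (crit-divisibleExceptAtMost-e∸1 (∣-fromDefs D B∣e))
  where
  open PrimePowerDegree D (proj₁ ufd) cz iq (ℕ.>-nonZero⁻¹ e ⦃ nonZero-e ⦄) (isPrimeElem⇒Prime D prime) N root₀
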